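{- Let $(\mathcal{P},\mathcal{L})$ be a finite affine plane of odd order $q$, and let $H$ and $V$ be two distinct parallel classes of its lines. If $S\subseteq\mathcal{P}$ is a generalized permutation (with respect to $H$ and $V$), then some line of the plane contains at least three points of $S$.
   Context: A finite affine plane of order $q$ has $q^2$ points, each line has $q$ points, and its lines are partitioned into $q+1$ parallel classes, each consisting of $q$ pairwise disjoint lines partitioning $\mathcal{P}$. A generalized permutation is a set $S\subseteq\mathcal{P}$ that is a transversal of both $H$ and $V$: for every line $\ell\in H\cup V$ there is exactly one $p\in S$ with $p\in\ell$. -}

module Defs where

open import Data.Nat using (ℕ; _%_)
open import Data.Fin using (Fin)
open import Data.Fin.Subset using (Subset; _∈_; _∉_; ∣_∣)
open import Data.Product using (Σ; ∃; _×_; _,_)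
open import Data.Sum using (_⊎_)
open import Data.Empty using (⊥)
open import Relation.Nullary using (¬_)
open import Relation.Binary.PropositionalEquality using (_≡_; _≢_)
open import Function.Bundles using (_⇔_)

Disjoint : ∀ {n} → Subset n → Subset n → Set
Disjoint A B = ∀ p → p ∈ A → p ∈ B → ⊥

record AffinePlane (q : ℕ) : Set where
  field
    nP nL : ℕ
    line : Fin nL → Subset nP
    join : ∀ (p p′ : Fin nP) → p ≢ p′ →
      Σ (Fin nL) λ l → (p ∈ line l) × (p′ ∈ line l) ×
        (∀ l′ → p ∈ line l′ → p′ ∈ line l′ → l′ ≡ l)
    playfair : ∀ (p : Fin nP) (l : Fin nL) → p ∉ line l →
      Σ (Fin nL) λ l′ → (p ∈ line l′) × Disjoint (line l) (line l′) ×
        (∀ l″ → p ∈ line l″ → Disjoint (line l) (line l″) → l″ ≡ l′)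
    nondegenerate : Σ (Fin nP) λ a → Σ (Fin nP) λ b → Σ (Fin nP) λ c →
      (a ≢ b) × (a ≢ c) × (b ≢ c) ×
      ¬ (Σ (Fin nL) λ l → (a ∈ line l) × (b ∈ line l) × (c ∈ line l))
    lineSize : ∀ l → ∣ line l ∣ ≡ q

module _ {q : ℕ} (Π : AffinePlane q) where
  open AffinePlane Π

  Parallel : Fin nL → Fin nL → Set
  Parallel l m = (l ≡ m) ⊎ Disjoint (line l) (line m)

  IsParallelClass : Subset nL → Set
  IsParallelClass C = ∃ λ l → ∀ m → (m ∈ C) ⇔ Parallel l m

  Transversal : Subset nP → Subset nL → Set
  Transversal S C = ∀ l → l ∈ C →
    Σ (Fin nP) λ p → (p ∈ S) × (p ∈ line l) ×
      (∀ p′ → p′ ∈ S → p′ ∈ line l → p′ ≡ p)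

  GeneralizedPermutation : Subset nL → Subset nL → Subset nP → Set
  GeneralizedPermutation H V S = Transversal S H × Transversal S V

  HasThreeCollinear : Subset nP → Set
  HasThreeCollinear S = Σ (Fin nL) λ l → Σ (Fin nP) λ a → Σ (Fin nP) λ b → Σ (Fin nP) λ c →
    (a ≢ b) × (a ≢ c) × (b ≢ c) ×
    (a ∈ S) × (b ∈ S) × (c ∈ S) ×
    (a ∈ line l) × (b ∈ line l) × (c ∈ line l)

-- Suppose no line meets S in three points.  Let M be the parallel class of a line through two
-- points of S; M is neither H nor V.  For p ∈ S the lines joining p to the other q - 1 points of
-- S are pairwise distinct and lie outside H ∪ V, and there are exactly q - 1 lines through p
-- outside H ∪ V; so the M-line through p contains a unique second point of S, the mate of p.
-- Mating is a fixed-point-free involution of S, and rows identify S with any line of V, so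
-- q is even.
module Submission where

open import Defs
open import Data.Nat using (ℕ; zero; suc; _%_; _≤_; s≤s⁻¹)
open import Data.Nat.Properties using (suc-injective; 0≢1+n; ≤-refl)
open import Data.Fin using (Fin; zero; suc; _≟_)
open import Data.Fin.Properties using (any?)
open import Data.Fin.Subset using (Subset; inside; outside; _∈_; _∉_; ∣_∣; _-_; ⁅_⁆; Nonempty)
open import Data.Fin.Subset.Properties
  using (_∈?_; p─⊥≡p; p─q⊆p; x∈p∧x≢y⇒x∈p-y; nonempty?; Empty-unique; ∣⊥∣≡0; ⊆-antisym)
open import Data.Vec.Base using (_∷_; here; there)
open import Data.Product using (Σ; ∃; ∃₂; _×_; _,_; proj₁; proj₂)
open import Data.Sum using (_⊎_; inj₁; inj₂)
open import Data.Empty using (⊥-elim)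
open import Relation.Nullary using (¬_; Dec; yes; no; contradiction)
open import Relation.Nullary.Decidable using (_×-dec_; ¬?)
open import Relation.Binary.PropositionalEquality
  using (_≡_; _≢_; refl; sym; trans; cong; subst; subst₂; module ≡-Reasoning)
open import Function.Bundles using (Equivalence)

∣p∣≡1+∣p-x∣ : ∀ {n x} (p : Subset n) → x ∈ p → ∣ p ∣ ≡ suc ∣ p - x ∣
∣p∣≡1+∣p-x∣ (inside ∷ p) here = cong (λ r → suc ∣ r ∣) (sym (p─⊥≡p p))
∣p∣≡1+∣p-x∣ (inside ∷ p) (there x∈p) = cong suc (∣p∣≡1+∣p-x∣ p x∈p)
∣p∣≡1+∣p-x∣ (outside ∷ p) (there x∈p) = ∣p∣≡1+∣p-x∣ p x∈p

x∉p-x : ∀ {n} (p : Subset n) (x : Fin n) → x ∉ p - x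
x∉p-x (_ ∷ p) zero ()
x∉p-x (_ ∷ p) (suc x) (there x∈p-x) = x∉p-x p x x∈p-x

x∈p-y⇒x∈p : ∀ {n} {p : Subset n} {x y} → x ∈ p - y → x ∈ p
x∈p-y⇒x∈p {p = p} {y = y} = p─q⊆p p ⁅ y ⁆

x∈p-y⇒x≢y : ∀ {n} {p : Subset n} {x y} → x ∈ p - y → x ≢ y
x∈p-y⇒x≢y {p = p} {x} x∈p-x refl = x∉p-x p x x∈p-x

∣p∣≡1+k⇒nonempty : ∀ {n k} (p : Subset n) → ∣ p ∣ ≡ suc k → Nonempty p
∣p∣≡1+k⇒nonempty {n} p ∣p∣≡1+k with nonempty? p
... | yes p≢∅ = p≢∅
... | no p≡∅ = contradiction
  (trans (sym (∣⊥∣≡0 n)) (trans (cong ∣_∣ (sym (Empty-unique p≡∅))) ∣p∣≡1+k)) 0≢1+n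

record FixedPointFreeInvolution {n} (f : Fin n → Fin n) (A : Subset n) : Set where
  field
    closed         : ∀ {x} → x ∈ A → f x ∈ A
    no-fixed-point : ∀ {x} → x ∈ A → f x ≢ x
    involutive     : ∀ {x} → x ∈ A → f (f x) ≡ x

module _ {n} {f : Fin n → Fin n} where

  remove-orbit : ∀ {A x} → FixedPointFreeInvolution f A → x ∈ A →
    FixedPointFreeInvolution f (A - x - f x)
  remove-orbit {A} {x} inv x∈A = record
    { closed         = closed′
    ; no-fixed-point = λ y∈ → no-fixed-point (x∈p-y⇒x∈p (x∈p-y⇒x∈p y∈))
    ; involutive     = λ y∈ → involutive (x∈p-y⇒x∈p (x∈p-y⇒x∈p y∈))
    }
    where
    open FixedPointFreeInvolution inv
    closed′ : ∀ {y} → y ∈ A - x - f x → f y ∈ A - x - f x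
    closed′ {y} y∈ = x∈p∧x≢y⇒x∈p-y (x∈p∧x≢y⇒x∈p-y (closed y∈A) fy≢x) fy≢fx
      where
      y∈A-x = x∈p-y⇒x∈p y∈
      y∈A = x∈p-y⇒x∈p y∈A-x
      fy≢x : f y ≢ x
      fy≢x fy≡x = x∈p-y⇒x≢y y∈ (trans (sym (involutive y∈A)) (cong f fy≡x))
      fy≢fx : f y ≢ f x
      fy≢fx fy≡fx = x∈p-y⇒x≢y y∈A-x
        (trans (sym (involutive y∈A)) (trans (cong f fy≡fx) (involutive x∈A)))

  fixedPointFreeInvolution⇒even : ∀ {A} → FixedPointFreeInvolution f A → ∣ A ∣ % 2 ≡ 0
  fixedPointFreeInvolution⇒even inv = even _ inv refl
    where
    ∣A∣≡2+∣A-x-fx∣ : ∀ {A x} → FixedPointFreeInvolution f A → x ∈ A →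
      ∣ A ∣ ≡ suc (suc ∣ A - x - f x ∣)
    ∣A∣≡2+∣A-x-fx∣ {A} {x} inv x∈A = trans (∣p∣≡1+∣p-x∣ A x∈A) (cong suc
      (∣p∣≡1+∣p-x∣ (A - x) (x∈p∧x≢y⇒x∈p-y (closed x∈A) (no-fixed-point x∈A))))
      where open FixedPointFreeInvolution inv
    even : ∀ k {A} → FixedPointFreeInvolution f A → ∣ A ∣ ≡ k → k % 2 ≡ 0
    even zero _ _ = refl
    even (suc k) {A} inv ∣A∣≡1+k with ∣p∣≡1+k⇒nonempty A ∣A∣≡1+k
    even (suc zero) inv ∣A∣≡1 | x , x∈A =
      contradiction (suc-injective (trans (sym ∣A∣≡1) (∣A∣≡2+∣A-x-fx∣ inv x∈A))) 0≢1+n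
    even (suc (suc k)) inv ∣A∣≡2+k | x , x∈A = even k (remove-orbit inv x∈A)
      (suc-injective (suc-injective (trans (sym (∣A∣≡2+∣A-x-fx∣ inv x∈A)) ∣A∣≡2+k)))

  injective⇒surjective : ∀ {A B : Subset n} → (∀ {x} → x ∈ A → f x ∈ B) →
    (∀ {x y} → x ∈ A → y ∈ A → f x ≡ f y → x ≡ y) → ∣ B ∣ ≤ ∣ A ∣ →
    ∀ {y} → y ∈ B → ∃ λ x → x ∈ A × f x ≡ y
  injective⇒surjective maps inj ∣B∣≤∣A∣ = go _ maps inj ∣B∣≤∣A∣ refl
    where
    go : ∀ k {A B : Subset n} → (∀ {x} → x ∈ A → f x ∈ B) →
      (∀ {x y} → x ∈ A → y ∈ A → f x ≡ f y → x ≡ y) → ∣ B ∣ ≤ ∣ A ∣ → ∣ A ∣ ≡ k →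
      ∀ {y} → y ∈ B → ∃ λ x → x ∈ A × f x ≡ y
    go zero {B = B} _ _ ∣B∣≤∣A∣ ∣A∣≡0 y∈B
      with () ← subst₂ _≤_ (∣p∣≡1+∣p-x∣ B y∈B) ∣A∣≡0 ∣B∣≤∣A∣
    go (suc k) {A} {B} maps inj ∣B∣≤∣A∣ ∣A∣≡1+k {y} y∈B
      with x , x∈A ← ∣p∣≡1+k⇒nonempty A ∣A∣≡1+k
      with f x ≟ y
    ... | yes fx≡y = x , x∈A , fx≡y
    ... | no fx≢y =
      let x′ , x′∈A-x , fx′≡y = go k maps′ inj′ ∣B-fx∣≤∣A-x∣ ∣A-x∣≡k
                                  (x∈p∧x≢y⇒x∈p-y y∈B (λ y≡fx → fx≢y (sym y≡fx)))
      in x′ , x∈p-y⇒x∈p x′∈A-x , fx′≡y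
      where
      maps′ : ∀ {z} → z ∈ A - x → f z ∈ B - f x
      maps′ z∈ = x∈p∧x≢y⇒x∈p-y (maps (x∈p-y⇒x∈p z∈))
        (λ fz≡fx → x∈p-y⇒x≢y z∈ (inj (x∈p-y⇒x∈p z∈) x∈A fz≡fx))
      inj′ : ∀ {z w} → z ∈ A - x → w ∈ A - x → f z ≡ f w → z ≡ w
      inj′ z∈ w∈ = inj (x∈p-y⇒x∈p z∈) (x∈p-y⇒x∈p w∈)
      ∣B-fx∣≤∣A-x∣ : ∣ B - f x ∣ ≤ ∣ A - x ∣
      ∣B-fx∣≤∣A-x∣ = s≤s⁻¹ (subst₂ _≤_ (∣p∣≡1+∣p-x∣ B (maps x∈A)) (∣p∣≡1+∣p-x∣ A x∈A) ∣B∣≤∣A∣)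
      ∣A-x∣≡k : ∣ A - x ∣ ≡ k
      ∣A-x∣≡k = suc-injective (trans (sym (∣p∣≡1+∣p-x∣ A x∈A)) ∣A∣≡1+k)

module AffinePlaneProperties {q : ℕ} (Π : AffinePlane q) where
  open AffinePlane Π

  infix 4 _∥_
  _∥_ : Fin nL → Fin nL → Set
  _∥_ = Parallel Π

  ∥-sym : ∀ {a b} → a ∥ b → b ∥ a
  ∥-sym (inj₁ a≡b) = inj₁ (sym a≡b)
  ∥-sym (inj₂ disjoint) = inj₂ (λ x x∈b x∈a → disjoint x x∈a x∈b)

  playfair-unique : ∀ {m a b x} → m ∥ a → m ∥ b → x ∈ line a → x ∈ line b → a ≡ b
  playfair-unique (inj₁ refl) (inj₁ refl) _ _ = refl
  playfair-unique (inj₁ refl) (inj₂ disjoint) x∈a x∈b = ⊥-elim (disjoint _ x∈a x∈b)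
  playfair-unique (inj₂ disjoint) (inj₁ refl) x∈a x∈b = ⊥-elim (disjoint _ x∈b x∈a)
  playfair-unique {m} {a} {b} {x} (inj₂ m∩a≡∅) (inj₂ m∩b≡∅) x∈a x∈b =
    let _ , _ , _ , unique = playfair x m (λ x∈m → m∩a≡∅ x x∈m x∈a)
    in trans (unique a x∈a m∩a≡∅) (sym (unique b x∈b m∩b≡∅))

  meet? : ∀ a b → Dec (∃ λ x → x ∈ line a × x ∈ line b)
  meet? a b = any? (λ x → (x ∈? line a) ×-dec (x ∈? line b))

  ∦⇒meet : ∀ {a b} → ¬ a ∥ b → ∃ λ x → x ∈ line a × x ∈ line b
  ∦⇒meet {a} {b} a∦b with meet? a b
  ... | yes meet = meet
  ... | no ¬meet = contradiction (inj₂ (λ x x∈a x∈b → ¬meet (x , x∈a , x∈b))) a∦b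

  ∥-trans : ∀ {a b c} → a ∥ b → b ∥ c → a ∥ c
  ∥-trans {a} {b} {c} a∥b b∥c with meet? a c
  ... | yes (x , x∈a , x∈c) = inj₁ (playfair-unique (∥-sym a∥b) b∥c x∈a x∈c)
  ... | no ¬meet = inj₂ (λ x x∈a x∈c → ¬meet (x , x∈a , x∈c))

  parallelThrough : ∀ x l → Σ (Fin nL) λ l′ → x ∈ line l′ × l ∥ l′
  parallelThrough x l with x ∈? line l
  ... | yes x∈l = l , x∈l , inj₁ refl
  ... | no x∉l = let l′ , x∈l′ , disjoint , _ = playfair x l x∉l in l′ , x∈l′ , inj₂ disjoint

  join-unique : ∀ {x y a b} → x ≢ y →
    x ∈ line a → y ∈ line a → x ∈ line b → y ∈ line b → a ≡ b
  join-unique {x} {y} {a} {b} x≢y x∈a y∈a x∈b y∈b =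
    let _ , _ , _ , unique = join x y x≢y
    in trans (unique a x∈a y∈a) (sym (unique b x∈b y∈b))

  pointOff : ∀ l → ∃ λ w → w ∉ line l
  pointOff l with nondegenerate
  ... | a , b , c , _ , _ , _ , ¬collinear with a ∈? line l | b ∈? line l | c ∈? line l
  ... | no a∉l | _ | _ = a , a∉l
  ... | yes _ | no b∉l | _ = b , b∉l
  ... | yes _ | yes _ | no c∉l = c , c∉l
  ... | yes a∈l | yes b∈l | yes c∈l = ⊥-elim (¬collinear (l , a∈l , b∈l , c∈l))

  module ParallelClass {C : Subset nL} (isClass : IsParallelClass Π C) where
    private
      r = proj₁ isClass

    member⇒∥ : ∀ {a} → a ∈ C → r ∥ a
    member⇒∥ {a} = Equivalence.to (proj₂ isClass a)

    ∥⇒member : ∀ {a} → r ∥ a → a ∈ C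
    ∥⇒member {a} = Equivalence.from (proj₂ isClass a)

    members-∥ : ∀ {a b} → a ∈ C → b ∈ C → a ∥ b
    members-∥ a∈C b∈C = ∥-trans (∥-sym (member⇒∥ a∈C)) (member⇒∥ b∈C)

    ∥-closed : ∀ {a b} → a ∈ C → a ∥ b → b ∈ C
    ∥-closed a∈C a∥b = ∥⇒member (∥-trans (member⇒∥ a∈C) a∥b)

    unique : ∀ {a b x} → a ∈ C → b ∈ C → x ∈ line a → x ∈ line b → a ≡ b
    unique a∈C b∈C = playfair-unique (member⇒∥ a∈C) (member⇒∥ b∈C)

    opaque
      lineThrough : Fin nP → Fin nL
      lineThrough x = proj₁ (parallelThrough x r)

      ∈lineThrough : ∀ x → x ∈ line (lineThrough x)
      ∈lineThrough x = proj₁ (proj₂ (parallelThrough x r))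

      lineThrough∈ : ∀ x → lineThrough x ∈ C
      lineThrough∈ x = ∥⇒member (proj₂ (proj₂ (parallelThrough x r)))

  distinctClasses⇒∦ : ∀ {C D} → IsParallelClass Π C → IsParallelClass Π D → C ≢ D →
    ∀ {a b} → a ∈ C → b ∈ D → ¬ a ∥ b
  distinctClasses⇒∦ isC isD C≢D a∈C b∈D a∥b = C≢D (⊆-antisym
    (λ c∈C → D.∥-closed b∈D (∥-trans (∥-sym a∥b) (C.members-∥ a∈C c∈C)))
    (λ d∈D → C.∥-closed a∈C (∥-trans a∥b (D.members-∥ b∈D d∈D))))
    where
    module C = ParallelClass isC
    module D = ParallelClass isD

  module _ {S : Subset nP} {C : Subset nL} (transversal : Transversal Π S C) where

    transversal-unique : ∀ {l a b} → l ∈ C → a ∈ S → b ∈ S → a ∈ line l → b ∈ line l → a ≡ b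
    transversal-unique l∈C a∈S b∈S a∈l b∈l =
      let _ , _ , _ , unique = transversal _ l∈C
      in trans (unique _ a∈S a∈l) (sym (unique _ b∈S b∈l))

    secant∉ : ∀ {l a b} → a ≢ b → a ∈ S → b ∈ S → a ∈ line l → b ∈ line l → l ∉ C
    secant∉ a≢b a∈S b∈S a∈l b∈l l∈C = a≢b (transversal-unique l∈C a∈S b∈S a∈l b∈l)

module NoThreeCollinear {q : ℕ} (Π : AffinePlane q)
  {H V : Subset (AffinePlane.nL Π)} (isH : IsParallelClass Π H) (isV : IsParallelClass Π V)
  (H≢V : H ≢ V) {S : Subset (AffinePlane.nP Π)} (perm : GeneralizedPermutation Π H V S)
  (noThree : ¬ HasThreeCollinear Π S) where

  open AffinePlane Π
  open AffinePlaneProperties Π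
  private
    module H = ParallelClass isH
    module V = ParallelClass isV
    Point = Fin nP
    Line = Fin nL

  rowsTransversal : Transversal Π S H
  rowsTransversal = proj₁ perm

  columnsTransversal : Transversal Π S V
  columnsTransversal = proj₂ perm

  row column : Point → Line
  row = H.lineThrough
  column = V.lineThrough

  row∦column : ∀ {a b} → a ∈ H → b ∈ V → ¬ a ∥ b
  row∦column = distinctClasses⇒∦ isH isV H≢V

  row≢column : ∀ {a b} → a ∈ H → b ∈ V → a ≢ b
  row≢column a∈H b∈V refl = row∦column a∈H b∈V (inj₁ refl)

  row∩column-unique : ∀ {a b x y} → a ∈ H → b ∈ V →
    x ∈ line a → x ∈ line b → y ∈ line a → y ∈ line b → x ≡ y
  row∩column-unique {x = x} {y} a∈H b∈V x∈a x∈b y∈a y∈b with x ≟ y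
  ... | yes x≡y = x≡y
  ... | no x≢y = contradiction (join-unique x≢y x∈a y∈a x∈b y∈b) (row≢column a∈H b∈V)

  collinear-unique : ∀ {a b c l} → a ∈ S → b ∈ S → c ∈ S →
    a ∈ line l → b ∈ line l → c ∈ line l → a ≢ b → a ≢ c → b ≡ c
  collinear-unique {a} {b} {c} {l} a∈S b∈S c∈S a∈l b∈l c∈l a≢b a≢c with b ≟ c
  ... | yes b≡c = b≡c
  ... | no b≢c =
    ⊥-elim (noThree (l , a , b , c , a≢b , a≢c , b≢c , a∈S , b∈S , c∈S , a∈l , b∈l , c∈l))

  opaque
    rowPoint : Point → Point
    rowPoint x = proj₁ (rowsTransversal (row x) (H.lineThrough∈ x))

    rowPoint∈S : ∀ x → rowPoint x ∈ S
    rowPoint∈S x = proj₁ (proj₂ (rowsTransversal (row x) (H.lineThrough∈ x)))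

    rowPoint∈row : ∀ x → rowPoint x ∈ line (row x)
    rowPoint∈row x = proj₁ (proj₂ (proj₂ (rowsTransversal (row x) (H.lineThrough∈ x))))

  rowPoint-unique : ∀ {s} x → s ∈ S → s ∈ line (row x) → s ≡ rowPoint x
  rowPoint-unique x s∈S s∈row =
    transversal-unique rowsTransversal (H.lineThrough∈ x) s∈S (rowPoint∈S x) s∈row (rowPoint∈row x)

  sameRow⇒sameRowPoint : ∀ {x} y → x ∈ line (row y) → rowPoint x ≡ rowPoint y
  sameRow⇒sameRowPoint {x} y x∈row-y = rowPoint-unique y (rowPoint∈S x)
    (subst (λ l → rowPoint x ∈ line l)
      (H.unique (H.lineThrough∈ x) (H.lineThrough∈ y) (H.∈lineThrough x) x∈row-y)
      (rowPoint∈row x))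

  rowPoint-fixes-S : ∀ {s} → s ∈ S → rowPoint s ≡ s
  rowPoint-fixes-S {s} s∈S = sym (rowPoint-unique s s∈S (H.∈lineThrough s))

  sameRowPoint⇒sameRow : ∀ x y → rowPoint x ≡ rowPoint y → row x ≡ row y
  sameRowPoint⇒sameRow x y eq = H.unique (H.lineThrough∈ x) (H.lineThrough∈ y)
    (rowPoint∈row x) (subst (λ s → s ∈ line (row y)) (sym eq) (rowPoint∈row y))

  rowPoint-injectiveOnColumn : ∀ {ℓ} x y → ℓ ∈ V → x ∈ line ℓ → y ∈ line ℓ →
    rowPoint x ≡ rowPoint y → x ≡ y
  rowPoint-injectiveOnColumn x y ℓ∈V x∈ℓ y∈ℓ eq = row∩column-unique
    (H.lineThrough∈ x) ℓ∈V (H.∈lineThrough x) x∈ℓ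
    (subst (λ l → y ∈ line l) (sym (sameRowPoint⇒sameRow x y eq)) (H.∈lineThrough y)) y∈ℓ

  S∩line⊆pair : ∀ {a b s l} → a ∈ S → b ∈ S → s ∈ S →
    a ∈ line l → b ∈ line l → s ∈ line l → a ≢ b → s ≡ a ⊎ s ≡ b
  S∩line⊆pair {a} {s = s} a∈S b∈S s∈S a∈l b∈l s∈l a≢b with s ≟ a
  ... | yes s≡a = inj₁ s≡a
  ... | no s≢a = inj₂ (collinear-unique a∈S s∈S b∈S a∈l s∈l b∈l (λ a≡s → s≢a (sym a≡s)) a≢b)

  module Secant {p : Point} (p∈S : p ∈ S) where

    -- The line through p and the point of S in the row of x; the row itself if that point is p.
    record Ray (x : Point) (r : Line) : Set where
      field
        p∈ray        : p ∈ line r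
        rowPoint∈ray : rowPoint x ∈ line r
        ray∉V        : r ∉ V
        S∩ray        : ∀ {s} → s ∈ S → s ∈ line r → s ≡ p ⊎ s ≡ rowPoint x
        ray∈H        : rowPoint x ≡ p → r ∈ H

    opaque
      ray : ∀ x → Σ Line (Ray x)
      ray x with rowPoint x ≟ p
      ... | yes rowPoint≡p = row x , record
        { p∈ray        = subst (λ s → s ∈ line (row x)) rowPoint≡p (rowPoint∈row x)
        ; rowPoint∈ray = rowPoint∈row x
        ; ray∉V        = λ row∈V → row≢column (H.lineThrough∈ x) row∈V refl
        ; S∩ray        = λ s∈S s∈row → inj₂ (rowPoint-unique x s∈S s∈row)
        ; ray∈H        = λ _ → H.lineThrough∈ x
        }
      ... | no rowPoint≢p =
        let r , rowPoint∈r , p∈r , _ = join (rowPoint x) p rowPoint≢p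
        in r , record
          { p∈ray        = p∈r
          ; rowPoint∈ray = rowPoint∈r
          ; ray∉V        = secant∉ columnsTransversal rowPoint≢p (rowPoint∈S x) p∈S rowPoint∈r p∈r
          ; S∩ray        = λ s∈S s∈r →
              S∩line⊆pair p∈S (rowPoint∈S x) s∈S p∈r rowPoint∈r s∈r (λ p≡ → rowPoint≢p (sym p≡))
          ; ray∈H        = λ rowPoint≡p → contradiction rowPoint≡p rowPoint≢p
          }

    rayLine : Point → Line
    rayLine x = proj₁ (ray x)

    module _ (x : Point) where
      open Ray (proj₂ (ray x)) public

    sameRay⇒sameRowPoint : ∀ x y → rayLine x ≡ rayLine y → rowPoint x ≡ rowPoint y
    sameRay⇒sameRowPoint x y same
      with S∩ray x (rowPoint∈S y) (subst (λ r → rowPoint y ∈ line r) (sym same) (rowPoint∈ray y))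
    ... | inj₂ y≈x = sym y≈x
    ... | inj₁ y≈p
      with S∩ray y (rowPoint∈S x) (subst (λ r → rowPoint x ∈ line r) same (rowPoint∈ray x))
    ...   | inj₁ x≈p = trans x≈p (sym y≈p)
    ...   | inj₂ x≈y = x≈y

    ℓ : Line
    ℓ = column (proj₁ (pointOff (column p)))

    ℓ∈V : ℓ ∈ V
    ℓ∈V = V.lineThrough∈ _

    p∉ℓ : p ∉ line ℓ
    p∉ℓ p∈ℓ = let w , w∉column-p = pointOff (column p) in
      w∉column-p (subst (λ l → w ∈ line l)
        (V.unique ℓ∈V (V.lineThrough∈ p) p∈ℓ (V.∈lineThrough p)) (V.∈lineThrough w))

    ray∦ℓ : ∀ x → ¬ rayLine x ∥ ℓ
    ray∦ℓ x ray∥ℓ = ray∉V x (V.∥-closed ℓ∈V (∥-sym ray∥ℓ))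

    -- A line through p outside V is determined by where it meets the column ℓ ∌ p, so
    -- counting such lines becomes the statement that φ : ℓ → ℓ is injective, hence onto.
    φ : Point → Point
    φ x = proj₁ (∦⇒meet (ray∦ℓ x))

    φ∈ray : ∀ x → φ x ∈ line (rayLine x)
    φ∈ray x = proj₁ (proj₂ (∦⇒meet (ray∦ℓ x)))

    φ∈ℓ : ∀ x → φ x ∈ line ℓ
    φ∈ℓ x = proj₂ (proj₂ (∦⇒meet (ray∦ℓ x)))

    line-through-p-unique : ∀ {a b y} → y ∈ line ℓ →
      p ∈ line a → y ∈ line a → p ∈ line b → y ∈ line b → a ≡ b
    line-through-p-unique y∈ℓ = join-unique (λ { refl → p∉ℓ y∈ℓ })

    φ-injective : ∀ {x y} → x ∈ line ℓ → y ∈ line ℓ → φ x ≡ φ y → x ≡ y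
    φ-injective {x} {y} x∈ℓ y∈ℓ φx≡φy = rowPoint-injectiveOnColumn x y ℓ∈V x∈ℓ y∈ℓ
      (sameRay⇒sameRowPoint x y (line-through-p-unique (φ∈ℓ x) (p∈ray x) (φ∈ray x)
        (p∈ray y) (subst (λ z → z ∈ line (rayLine y)) (sym φx≡φy) (φ∈ray y))))

    secant : ∀ {k} → p ∈ line k → k ∉ H → k ∉ V → ∃ λ t → t ∈ S × t ∈ line k × t ≢ p
    secant {k} p∈k k∉H k∉V
      with y , y∈k , y∈ℓ ← ∦⇒meet (λ k∥ℓ → k∉V (V.∥-closed ℓ∈V (∥-sym k∥ℓ)))
      with x , x∈ℓ , φx≡y ← injective⇒surjective (λ {x} _ → φ∈ℓ x) φ-injective ≤-refl y∈ℓ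
      with ray≡k ← line-through-p-unique y∈ℓ (p∈ray x)
                     (subst (λ z → z ∈ line (rayLine x)) φx≡y (φ∈ray x)) p∈k y∈k
      with rowPoint x ≟ p
    ... | yes rowPoint≡p = contradiction (subst (_∈ H) ray≡k (ray∈H x rowPoint≡p)) k∉H
    ... | no rowPoint≢p =
      rowPoint x , rowPoint∈S x , subst (λ l → rowPoint x ∈ line l) ray≡k (rowPoint∈ray x) ,
      rowPoint≢p

  open Secant using (secant)

  somePoint : Point
  somePoint = proj₁ nondegenerate

  twoPointsOfS : ∃₂ λ a b → a ∈ S × b ∈ S × a ≢ b
  twoPointsOfS = rowPoint x , rowPoint z , rowPoint∈S x , rowPoint∈S z , rowPoint-x≢rowPoint-z
    where
    x = somePoint
    z = proj₁ (pointOff (row x))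
    rowPoint-x≢rowPoint-z : rowPoint x ≢ rowPoint z
    rowPoint-x≢rowPoint-z eq = proj₂ (pointOff (row x))
      (subst (λ l → z ∈ line l) (sym (sameRowPoint⇒sameRow x z eq)) (H.∈lineThrough z))

  diagonal : Σ Line λ m → m ∉ H × m ∉ V
  diagonal
    with a , b , a∈S , b∈S , a≢b ← twoPointsOfS
    with m , a∈m , b∈m , _ ← join a b a≢b
    = m , secant∉ rowsTransversal a≢b a∈S b∈S a∈m b∈m ,
          secant∉ columnsTransversal a≢b a∈S b∈S a∈m b∈m

  opaque
    slope : Point → Line
    slope x = proj₁ (parallelThrough x (proj₁ diagonal))

    ∈slope : ∀ x → x ∈ line (slope x)
    ∈slope x = proj₁ (proj₂ (parallelThrough x (proj₁ diagonal)))

    diagonal∥slope : ∀ x → proj₁ diagonal ∥ slope x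
    diagonal∥slope x = proj₂ (proj₂ (parallelThrough x (proj₁ diagonal)))

  slope∉H : ∀ x → slope x ∉ H
  slope∉H x slope∈H = proj₁ (proj₂ diagonal) (H.∥-closed slope∈H (∥-sym (diagonal∥slope x)))

  slope∉V : ∀ x → slope x ∉ V
  slope∉V x slope∈V = proj₂ (proj₂ diagonal) (V.∥-closed slope∈V (∥-sym (diagonal∥slope x)))

  slope-unique : ∀ {x} y → x ∈ line (slope y) → slope x ≡ slope y
  slope-unique {x} y x∈slope =
    playfair-unique (diagonal∥slope x) (diagonal∥slope y) (∈slope x) x∈slope

  opaque
    mate-of-rowPoint : ∀ x → ∃ λ t → t ∈ S × t ∈ line (slope (rowPoint x)) × t ≢ rowPoint x
    mate-of-rowPoint x =
      secant (rowPoint∈S x) (∈slope (rowPoint x)) (slope∉H (rowPoint x)) (slope∉V (rowPoint x))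

  mate : Point → Point
  mate x = proj₁ (mate-of-rowPoint x)

  mate∈S : ∀ x → mate x ∈ S
  mate∈S x = proj₁ (proj₂ (mate-of-rowPoint x))

  mate∈slope : ∀ x → mate x ∈ line (slope (rowPoint x))
  mate∈slope x = proj₁ (proj₂ (proj₂ (mate-of-rowPoint x)))

  mate≢rowPoint : ∀ x → mate x ≢ rowPoint x
  mate≢rowPoint x = proj₂ (proj₂ (proj₂ (mate-of-rowPoint x)))

  mate-unique : ∀ {t} x → t ∈ S → t ∈ line (slope (rowPoint x)) → t ≢ rowPoint x → t ≡ mate x
  mate-unique x t∈S t∈slope t≢rowPoint = collinear-unique (rowPoint∈S x) t∈S (mate∈S x)
    (∈slope (rowPoint x)) t∈slope (mate∈slope x)
    (λ eq → t≢rowPoint (sym eq)) (λ eq → mate≢rowPoint x (sym eq))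

  sameRowPoint⇒sameMate : ∀ x y → rowPoint x ≡ rowPoint y → mate x ≡ mate y
  sameRowPoint⇒sameMate x y eq = mate-unique y (mate∈S x)
    (subst (λ s → mate x ∈ line (slope s)) eq (mate∈slope x))
    (λ mate≡ → mate≢rowPoint x (trans mate≡ (sym eq)))

  mate-involutive : ∀ x → mate (mate x) ≡ rowPoint x
  mate-involutive x = sym (mate-unique (mate x) (rowPoint∈S x) rowPoint∈slope rowPoint≢)
    where
    rowPoint-mate : rowPoint (mate x) ≡ mate x
    rowPoint-mate = rowPoint-fixes-S (mate∈S x)
    rowPoint∈slope : rowPoint x ∈ line (slope (rowPoint (mate x)))
    rowPoint∈slope = subst (λ l → rowPoint x ∈ line l)
      (sym (trans (cong slope rowPoint-mate) (slope-unique (rowPoint x) (mate∈slope x))))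
      (∈slope (rowPoint x))
    rowPoint≢ : rowPoint x ≢ rowPoint (mate x)
    rowPoint≢ eq = mate≢rowPoint x (sym (trans eq rowPoint-mate))

  module Swap {c : Line} (c∈V : c ∈ V) where

    opaque
      row∩c : ∀ y → ∃ λ z → z ∈ line (row y) × z ∈ line c
      row∩c y = ∦⇒meet (row∦column (H.lineThrough∈ y) c∈V)

    toColumn : Point → Point
    toColumn y = proj₁ (row∩c y)

    toColumn∈row : ∀ y → toColumn y ∈ line (row y)
    toColumn∈row y = proj₁ (proj₂ (row∩c y))

    toColumn∈c : ∀ y → toColumn y ∈ line c
    toColumn∈c y = proj₂ (proj₂ (row∩c y))

    rowPoint-toColumn : ∀ y → rowPoint (toColumn y) ≡ rowPoint y
    rowPoint-toColumn y = sameRow⇒sameRowPoint y (toColumn∈row y)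

    toColumn-rowPoint : ∀ {x} → x ∈ line c → toColumn (rowPoint x) ≡ x
    toColumn-rowPoint {x} x∈c = row∩column-unique (H.lineThrough∈ x) c∈V
      (subst (λ l → toColumn (rowPoint x) ∈ line l)
        (sameRowPoint⇒sameRow (rowPoint x) x (rowPoint-fixes-S (rowPoint∈S x)))
        (toColumn∈row (rowPoint x)))
      (toColumn∈c (rowPoint x)) (H.∈lineThrough x) x∈c

    swap : Point → Point
    swap x = toColumn (mate x)

    swap-involution : FixedPointFreeInvolution swap (line c)
    swap-involution = record
      { closed         = λ {x} _ → toColumn∈c (mate x)
      ; no-fixed-point = no-fixed-point
      ; involutive     = involutive
      }
      where
      open ≡-Reasoning
      no-fixed-point : ∀ {x} → x ∈ line c → swap x ≢ x
      no-fixed-point {x} _ swap-x≡x = mate≢rowPoint x (begin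
        mate x                     ≡⟨ rowPoint-fixes-S (mate∈S x) ⟨
        rowPoint (mate x)          ≡⟨ rowPoint-toColumn (mate x) ⟨
        rowPoint (toColumn (mate x)) ≡⟨ cong rowPoint swap-x≡x ⟩
        rowPoint x                 ∎)
      involutive : ∀ {x} → x ∈ line c → swap (swap x) ≡ x
      involutive {x} x∈c = begin
        toColumn (mate (toColumn (mate x))) ≡⟨ cong toColumn
          (sameRowPoint⇒sameMate (toColumn (mate x)) (mate x) (rowPoint-toColumn (mate x))) ⟩
        toColumn (mate (mate x))            ≡⟨ cong toColumn (mate-involutive x) ⟩
        toColumn (rowPoint x)               ≡⟨ toColumn-rowPoint x∈c ⟩
        x                                   ∎

  q-even : q % 2 ≡ 0
  q-even = subst (λ n → n % 2 ≡ 0) (lineSize c) (fixedPointFreeInvolution⇒even swap-involution)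
    where
    c = column somePoint
    open Swap (V.lineThrough∈ somePoint)

hasThreeCollinear? : ∀ {q} (Π : AffinePlane q) S → Dec (HasThreeCollinear Π S)
hasThreeCollinear? Π S = any? λ l → any? λ a → any? λ b → any? λ c →
  ¬? (a ≟ b) ×-dec ¬? (a ≟ c) ×-dec ¬? (b ≟ c) ×-dec (a ∈? S) ×-dec (b ∈? S) ×-dec (c ∈? S) ×-dec
  (a ∈? line l) ×-dec (b ∈? line l) ×-dec (c ∈? line l)
  where open AffinePlane Π

mainTheorem7 : (q : ℕ) → q % 2 ≡ 1 → (Π : AffinePlane q) →
    (H V : Subset (AffinePlane.nL Π)) →
    IsParallelClass Π H → IsParallelClass Π V → H ≢ V →
    (S : Subset (AffinePlane.nP Π)) → GeneralizedPermutation Π H V S →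
    HasThreeCollinear Π S
mainTheorem7 q q-odd Π H V isH isV H≢V S perm with hasThreeCollinear? Π S
... | yes threeCollinear = threeCollinear
... | no noThree = contradiction (trans (sym q-even) q-odd) 0≢1+n
  where open NoThreeCollinear Π isH isV H≢V perm noThree using (q-even)
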